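{- For $n \geq 5$, let $G_n := (\mathbb{Z}/2\mathbb{Z})^n \times (\mathbb{Z}/4\mathbb{Z})^n$ and $H_n := (\mathbb{Z}/2\mathbb{Z})^{n-2}\times(\mathbb{Z}/4\mathbb{Z})^{n+1}$. Then $G_n \not\cong H_n$, $|G_n| = |H_n|$, and the $n/4$-dimensional count-free WL Version II algorithm (run for any number of rounds) does not distinguish $G_n$ from $H_n$.
   Context: Count-free WL Version II for groups, dimension $k$: $k$-tuples $(g_1,\dots,g_k)$ and $(h_1,\dots,h_k)$ get the same initial color iff $g_i\mapsto h_i$ extends to an isomorphism $\langle g_1,\dots,g_k\rangle\to\langle h_1,\dots,h_k\rangle$; refinement is $\chi_{t+1}(\bar g) = (\chi_t(\bar g), \{(\chi_t(\bar g(g_1/x)),\dots,\chi_t(\bar g(g_k/x))) : x \in G\})$ with a set (not multiset) of color tuples, where $\bar g(g_i/x)$ replaces the $i$-th entry by $x$. Two groups are distinguished if their orders differ or the sets of colors of their $k$-tuples differ at some round. -}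

module Defs where

open import Level using (0ℓ)
open import Data.Nat using (ℕ; zero; suc)
open import Data.Fin using (Fin)
open import Data.Fin.Properties using () renaming (_≟_ to _≟ᶠ_)
open import Data.Vec using (Vec; []; _∷_)
open import Data.Product using (Σ; ∃; _×_; _,_; proj₁; proj₂)
open import Function.Definitions using (Bijective)
open import Relation.Nullary using (yes; no)
open import Relation.Binary.PropositionalEquality using (_≡_; refl; cong₂)

record Grp : Set₁ where
  field
    Carrier   : Set
    _∙_       : Carrier → Carrier → Carrier
    ε         : Carrier
    _⁻¹       : Carrier → Carrier
    assoc     : ∀ x y z → (x ∙ y) ∙ z ≡ x ∙ (y ∙ z)
    identityˡ : ∀ x → ε ∙ x ≡ x
    identityʳ : ∀ x → x ∙ ε ≡ x
    inverseˡ  : ∀ x → (x ⁻¹) ∙ x ≡ ε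
    inverseʳ  : ∀ x → x ∙ (x ⁻¹) ≡ ε

open Grp

IsGroupIso : (G H : Grp) → (Carrier G → Carrier H) → Set
IsGroupIso G H f =
  (∀ x y → f (_∙_ G x y) ≡ _∙_ H (f x) (f y)) × Bijective _≡_ _≡_ f

_≅_ : Grp → Grp → Set
G ≅ H = Σ (Carrier G → Carrier H) (IsGroupIso G H)

data Z2 : Set where
  z2·0 z2·1 : Z2

_+2_ : Z2 → Z2 → Z2
z2·0 +2 z2·0 = z2·0
z2·0 +2 z2·1 = z2·1
z2·1 +2 z2·0 = z2·1
z2·1 +2 z2·1 = z2·0
neg2 : Z2 → Z2
neg2 z2·0 = z2·0
neg2 z2·1 = z2·1
assoc2 : ∀ a b c → (a +2 b) +2 c ≡ a +2 (b +2 c)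
assoc2 z2·0 z2·0 z2·0 = refl
assoc2 z2·0 z2·0 z2·1 = refl
assoc2 z2·0 z2·1 z2·0 = refl
assoc2 z2·0 z2·1 z2·1 = refl
assoc2 z2·1 z2·0 z2·0 = refl
assoc2 z2·1 z2·0 z2·1 = refl
assoc2 z2·1 z2·1 z2·0 = refl
assoc2 z2·1 z2·1 z2·1 = refl
idl2 : ∀ a → z2·0 +2 a ≡ a
idl2 z2·0 = refl
idl2 z2·1 = refl
idr2 : ∀ a → a +2 z2·0 ≡ a
idr2 z2·0 = refl
idr2 z2·1 = refl
invl2 : ∀ a → neg2 a +2 a ≡ z2·0
invl2 z2·0 = refl
invl2 z2·1 = refl
invr2 : ∀ a → a +2 neg2 a ≡ z2·0
invr2 z2·0 = refl
invr2 z2·1 = refl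

data Z4 : Set where
  z4·0 z4·1 z4·2 z4·3 : Z4

_+4_ : Z4 → Z4 → Z4
z4·0 +4 z4·0 = z4·0
z4·0 +4 z4·1 = z4·1
z4·0 +4 z4·2 = z4·2
z4·0 +4 z4·3 = z4·3
z4·1 +4 z4·0 = z4·1
z4·1 +4 z4·1 = z4·2
z4·1 +4 z4·2 = z4·3
z4·1 +4 z4·3 = z4·0
z4·2 +4 z4·0 = z4·2
z4·2 +4 z4·1 = z4·3
z4·2 +4 z4·2 = z4·0
z4·2 +4 z4·3 = z4·1
z4·3 +4 z4·0 = z4·3
z4·3 +4 z4·1 = z4·0
z4·3 +4 z4·2 = z4·1
z4·3 +4 z4·3 = z4·2
neg4 : Z4 → Z4
neg4 z4·0 = z4·0
neg4 z4·1 = z4·3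
neg4 z4·2 = z4·2
neg4 z4·3 = z4·1
assoc4 : ∀ a b c → (a +4 b) +4 c ≡ a +4 (b +4 c)
assoc4 z4·0 z4·0 z4·0 = refl
assoc4 z4·0 z4·0 z4·1 = refl
assoc4 z4·0 z4·0 z4·2 = refl
assoc4 z4·0 z4·0 z4·3 = refl
assoc4 z4·0 z4·1 z4·0 = refl
assoc4 z4·0 z4·1 z4·1 = refl
assoc4 z4·0 z4·1 z4·2 = refl
assoc4 z4·0 z4·1 z4·3 = refl
assoc4 z4·0 z4·2 z4·0 = refl
assoc4 z4·0 z4·2 z4·1 = refl
assoc4 z4·0 z4·2 z4·2 = refl
assoc4 z4·0 z4·2 z4·3 = refl
assoc4 z4·0 z4·3 z4·0 = refl
assoc4 z4·0 z4·3 z4·1 = refl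
assoc4 z4·0 z4·3 z4·2 = refl
assoc4 z4·0 z4·3 z4·3 = refl
assoc4 z4·1 z4·0 z4·0 = refl
assoc4 z4·1 z4·0 z4·1 = refl
assoc4 z4·1 z4·0 z4·2 = refl
assoc4 z4·1 z4·0 z4·3 = refl
assoc4 z4·1 z4·1 z4·0 = refl
assoc4 z4·1 z4·1 z4·1 = refl
assoc4 z4·1 z4·1 z4·2 = refl
assoc4 z4·1 z4·1 z4·3 = refl
assoc4 z4·1 z4·2 z4·0 = refl
assoc4 z4·1 z4·2 z4·1 = refl
assoc4 z4·1 z4·2 z4·2 = refl
assoc4 z4·1 z4·2 z4·3 = refl
assoc4 z4·1 z4·3 z4·0 = refl
assoc4 z4·1 z4·3 z4·1 = refl
assoc4 z4·1 z4·3 z4·2 = refl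
assoc4 z4·1 z4·3 z4·3 = refl
assoc4 z4·2 z4·0 z4·0 = refl
assoc4 z4·2 z4·0 z4·1 = refl
assoc4 z4·2 z4·0 z4·2 = refl
assoc4 z4·2 z4·0 z4·3 = refl
assoc4 z4·2 z4·1 z4·0 = refl
assoc4 z4·2 z4·1 z4·1 = refl
assoc4 z4·2 z4·1 z4·2 = refl
assoc4 z4·2 z4·1 z4·3 = refl
assoc4 z4·2 z4·2 z4·0 = refl
assoc4 z4·2 z4·2 z4·1 = refl
assoc4 z4·2 z4·2 z4·2 = refl
assoc4 z4·2 z4·2 z4·3 = refl
assoc4 z4·2 z4·3 z4·0 = refl
assoc4 z4·2 z4·3 z4·1 = refl
assoc4 z4·2 z4·3 z4·2 = refl
assoc4 z4·2 z4·3 z4·3 = refl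
assoc4 z4·3 z4·0 z4·0 = refl
assoc4 z4·3 z4·0 z4·1 = refl
assoc4 z4·3 z4·0 z4·2 = refl
assoc4 z4·3 z4·0 z4·3 = refl
assoc4 z4·3 z4·1 z4·0 = refl
assoc4 z4·3 z4·1 z4·1 = refl
assoc4 z4·3 z4·1 z4·2 = refl
assoc4 z4·3 z4·1 z4·3 = refl
assoc4 z4·3 z4·2 z4·0 = refl
assoc4 z4·3 z4·2 z4·1 = refl
assoc4 z4·3 z4·2 z4·2 = refl
assoc4 z4·3 z4·2 z4·3 = refl
assoc4 z4·3 z4·3 z4·0 = refl
assoc4 z4·3 z4·3 z4·1 = refl
assoc4 z4·3 z4·3 z4·2 = refl
assoc4 z4·3 z4·3 z4·3 = refl
idl4 : ∀ a → z4·0 +4 a ≡ a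
idl4 z4·0 = refl
idl4 z4·1 = refl
idl4 z4·2 = refl
idl4 z4·3 = refl
idr4 : ∀ a → a +4 z4·0 ≡ a
idr4 z4·0 = refl
idr4 z4·1 = refl
idr4 z4·2 = refl
idr4 z4·3 = refl
invl4 : ∀ a → neg4 a +4 a ≡ z4·0
invl4 z4·0 = refl
invl4 z4·1 = refl
invl4 z4·2 = refl
invl4 z4·3 = refl
invr4 : ∀ a → a +4 neg4 a ≡ z4·0
invr4 z4·0 = refl
invr4 z4·1 = refl
invr4 z4·2 = refl
invr4 z4·3 = refl

ℤ/2 : Grp
ℤ/2 = record { Carrier = Z2 ; _∙_ = _+2_ ; ε = z2·0 ; _⁻¹ = neg2
             ; assoc = assoc2 ; identityˡ = idl2 ; identityʳ = idr2
             ; inverseˡ = invl2 ; inverseʳ = invr2 }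

ℤ/4 : Grp
ℤ/4 = record { Carrier = Z4 ; _∙_ = _+4_ ; ε = z4·0 ; _⁻¹ = neg4
             ; assoc = assoc4 ; identityˡ = idl4 ; identityʳ = idr4
             ; inverseˡ = invl4 ; inverseʳ = invr4 }

module PowerOps (A : Grp) where
  open Grp A using () renaming (Carrier to C; _∙_ to _·_; ε to e; _⁻¹ to inv)

  mulV : ∀ {n} → Vec C n → Vec C n → Vec C n
  mulV [] [] = []
  mulV (x ∷ xs) (y ∷ ys) = (x · y) ∷ mulV xs ys

  oneV : ∀ n → Vec C n
  oneV zero = []
  oneV (suc n) = e ∷ oneV n

  invV : ∀ {n} → Vec C n → Vec C n
  invV [] = []
  invV (x ∷ xs) = inv x ∷ invV xs

  assocV : ∀ {n} (x y z : Vec C n) → mulV (mulV x y) z ≡ mulV x (mulV y z)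
  assocV [] [] [] = refl
  assocV (x ∷ xs) (y ∷ ys) (z ∷ zs) = cong₂ _∷_ (assoc A x y z) (assocV xs ys zs)

  idlV : ∀ {n} (x : Vec C n) → mulV (oneV n) x ≡ x
  idlV [] = refl
  idlV (x ∷ xs) = cong₂ _∷_ (identityˡ A x) (idlV xs)

  idrV : ∀ {n} (x : Vec C n) → mulV x (oneV n) ≡ x
  idrV [] = refl
  idrV (x ∷ xs) = cong₂ _∷_ (identityʳ A x) (idrV xs)

  invlV : ∀ {n} (x : Vec C n) → mulV (invV x) x ≡ oneV n
  invlV [] = refl
  invlV (x ∷ xs) = cong₂ _∷_ (inverseˡ A x) (invlV xs)

  invrV : ∀ {n} (x : Vec C n) → mulV x (invV x) ≡ oneV n
  invrV [] = refl
  invrV (x ∷ xs) = cong₂ _∷_ (inverseʳ A x) (invrV xs)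

_^ᴳ_ : Grp → ℕ → Grp
A ^ᴳ n = record { Carrier = Vec (Carrier A) n ; _∙_ = mulV ; ε = oneV n ; _⁻¹ = invV
                ; assoc = assocV ; identityˡ = idlV ; identityʳ = idrV
                ; inverseˡ = invlV ; inverseʳ = invrV }
  where open PowerOps A

_×ᴳ_ : Grp → Grp → Grp
A ×ᴳ B = record
  { Carrier = Carrier A × Carrier B
  ; _∙_ = λ p q → (_∙_ A (proj₁ p) (proj₁ q) , _∙_ B (proj₂ p) (proj₂ q))
  ; ε = (ε A , ε B)
  ; _⁻¹ = λ p → (_⁻¹ A (proj₁ p) , _⁻¹ B (proj₂ p))
  ; assoc = λ x y z → cong₂ _,_ (assoc A _ _ _) (assoc B _ _ _)
  ; identityˡ = λ x → cong₂ _,_ (identityˡ A _) (identityˡ B _)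
  ; identityʳ = λ x → cong₂ _,_ (identityʳ A _) (identityʳ B _)
  ; inverseˡ = λ x → cong₂ _,_ (inverseˡ A _) (inverseˡ B _)
  ; inverseʳ = λ x → cong₂ _,_ (inverseʳ A _) (inverseʳ B _)
  }

Tuple : Grp → ℕ → Set
Tuple G k = Fin k → Carrier G

_[_≔_] : ∀ {A : Set} {k} → (Fin k → A) → Fin k → A → (Fin k → A)
(g [ i ≔ x ]) j with j ≟ᶠ i
... | yes _ = x
... | no _  = g j

data Gen (G : Grp) {k : ℕ} (g : Tuple G k) : Carrier G → Set where
  gen : ∀ i → Gen G g (g i)
  one : Gen G g (ε G)
  mul : ∀ {x y} → Gen G g x → Gen G g y → Gen G g (_∙_ G x y)
  inv : ∀ {x} → Gen G g x → Gen G g (_⁻¹ G x)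

-- "gᵢ ↦ hᵢ extends to an isomorphism ⟨g̅⟩ → ⟨h̅⟩".
-- Elements of ⟨g̅⟩ are pairs (x , membership proof); they are equal when
-- their underlying group elements are equal (φ-wd, φ-inj).
record ExtendsToIso (G H : Grp) {k : ℕ} (g : Tuple G k) (h : Tuple H k) : Set where
  field
    φ      : Σ (Carrier G) (Gen G g) → Carrier H
    φ-wd   : ∀ a b → proj₁ a ≡ proj₁ b → φ a ≡ φ b
    φ-into : ∀ a → Gen H h (φ a)
    φ-hom  : ∀ a b → φ (_∙_ G (proj₁ a) (proj₁ b) , mul (proj₂ a) (proj₂ b))
                       ≡ _∙_ H (φ a) (φ b)
    φ-inj  : ∀ a b → φ a ≡ φ b → proj₁ a ≡ proj₁ b
    φ-surj : ∀ y → Gen H h y → Σ (Σ (Carrier G) (Gen G g)) (λ a → φ a ≡ y)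
    φ-ext  : ∀ i → φ (g i , gen i) ≡ h i

-- Colour equality at round t+1 means
-- equal colour at round t and equal *sets* of colour tuples
-- {(χ_t(g̅(g₁/x)),…,χ_t(g̅(g_k/x))) : x ∈ G}.
SameColor : ∀ (G H : Grp) {k : ℕ} → ℕ → Tuple G k → Tuple H k → Set
SameColor G H zero g h = ExtendsToIso G H g h
SameColor G H (suc t) g h =
  SameColor G H t g h
  × (∀ (x : Carrier G) → ∃ λ (y : Carrier H) → ∀ i → SameColor G H t (g [ i ≔ x ]) (h [ i ≔ y ]))
  × (∀ (y : Carrier H) → ∃ λ (x : Carrier G) → ∀ i → SameColor G H t (g [ i ≔ x ]) (h [ i ≔ y ]))

SameColorSets : ℕ → (G H : Grp) → ℕ → Set
SameColorSets k G H t =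
  (∀ (g : Tuple G k) → ∃ λ (h : Tuple H k) → SameColor G H t g h)
  × (∀ (h : Tuple H k) → ∃ λ (g : Tuple G k) → SameColor G H t g h)

SameOrder : Grp → Grp → Set
SameOrder G H = Σ (Carrier G → Carrier H) (Bijective _≡_ _≡_)

WLIINotDistinguish : ℕ → Grp → Grp → Set
WLIINotDistinguish k G H = SameOrder G H × (∀ t → SameColorSets k G H t)

open import Data.Nat using (_+_; _∸_)

Gₙ : ℕ → Grp
Gₙ n = (ℤ/2 ^ᴳ n) ×ᴳ (ℤ/4 ^ᴳ n)

Hₙ : ℕ → Grp
Hₙ n = (ℤ/2 ^ᴳ (n ∸ 2)) ×ᴳ (ℤ/4 ^ᴳ (n + 1))

-- Abelian groups of exponent 4 are ℤ/4-modules. Call k-tuples g of M and h of N alike if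
-- for every c ∈ (ℤ/4)ᵏ the combination Σ cᵢgᵢ vanishes iff Σ cᵢhᵢ does, and lies in 2M iff
-- Σ cᵢhᵢ lies in 2N. Then gᵢ ↦ hᵢ extends to an isomorphism ⟨g⟩ ≅ ⟨h⟩. An element x of M
-- lies in ⟨g⟩, or x + ⟨g⟩ meets 2M, or x is odd modulo ⟨g⟩ and the position of 2x relative
-- to ⟨g⟩ decides the rest. Since ⟨h⟩ has at most 4ᵏ elements, 2k below both ranks of
-- N = ℤ/2ᵃ × ℤ/4ᵇ leaves room for a y in the same position relative to ⟨h⟩, so (g, x) and
-- (h, y) are alike again. Hence alikeness survives every refinement round, and every tuple
-- has an alike partner. Finally Gₙ ≇ Hₙ because 2Gₙ has 2ⁿ elements and 2Hₙ has 2ⁿ⁺¹,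
-- while |Gₙ| = 2³ⁿ = |Hₙ|.

{-# OPTIONS --safe #-}
module Submission where

open import Defs
open import Data.Nat using (ℕ; _≤_; _/_)
open import Data.Product using (_×_)
open import Relation.Nullary using (¬_)

open import Level using (0ℓ)
open import Algebra.Bundles using (AbelianGroup)
import Algebra.Properties.AbelianGroup as AbelianGroupProperties
import Algebra.Properties.CommutativeSemigroup as CommutativeSemigroupProperties
open import Data.Empty using (⊥-elim)
open import Data.Fin as Fin using (Fin; zero; suc)
open import Data.Fin.Patterns using (0F; 1F; 2F; 3F)
import Data.Fin.Properties as Fin
open import Data.Nat as ℕ using (zero; suc; _<_; _^_; _*_; _+_; z≤n; s≤s)
import Data.Nat.DivMod as ℕ
import Data.Nat.Properties as ℕ
import Data.Nat.Tactic.RingSolver as RingSolver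
open import Data.Product using (∃; _,_; proj₁; proj₂)
open import Data.Product.Algebra using (×-cong)
open import Data.Vec as Vec using (Vec; []; _∷_; map; zipWith; replicate; lookup; _[_]≔_)
import Data.Vec.Properties as Vec
import Data.Vec.Recursive as Recursive
import Data.Vec.Recursive.Properties as Recursive
open import Data.Vec.Functional using (Vector; tail) renaming (_∷_ to _∷ᶠ_)
open import Function using (_∘_; _⇔_; mk⇔; Equivalence)
open import Function.Bundles using (_↔_; Inverse; Bijection; mk↔ₛ′)
open import Function.Definitions using (Injective)
open import Function.Properties.Inverse using (↔-sym; ↔-trans; ↔⇒⤖)
import Function.Properties.Equivalence as ⇔
open import Relation.Binary.Definitions using (DecidableEquality)
open import Relation.Binary.PropositionalEquality
open import Relation.Binary.PropositionalEquality.Algebra using (isMagma)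
open import Relation.Nullary using (Dec; yes; no)
open import Relation.Nullary.Decidable using (map′; from-yes)
open import Relation.Unary using (Pred; Decidable)

record Finite (A : Set) : Set where
  constructor finite
  field
    size : ℕ
    enum : A ↔ Fin size

module FiniteProperties {A : Set} (fin : Finite A) where
  open Finite fin
  open Inverse enum

  from-injective : Injective _≡_ _≡_ from
  from-injective {i} {j} eq =
    trans (sym (strictlyInverseˡ i)) (trans (cong to eq) (strictlyInverseˡ j))

  to-injective : Injective _≡_ _≡_ to
  to-injective {x} {y} eq =
    trans (sym (strictlyInverseʳ x)) (trans (cong from eq) (strictlyInverseʳ y))

  _≟_ : DecidableEquality A
  x ≟ y = map′ to-injective (cong to) (to x Fin.≟ to y)

  ∀Fin⇒∀ : {P : Pred A 0ℓ} → (∀ i → P (from i)) → ∀ x → P x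
  ∀Fin⇒∀ {P} ∀P x = subst P (strictlyInverseʳ x) (∀P (to x))

  all? : {P : Pred A 0ℓ} → Decidable P → Dec (∀ x → P x)
  all? P? = map′ ∀Fin⇒∀ (λ ∀P i → ∀P (from i)) (Fin.all? (P? ∘ from))

  any? : {P : Pred A 0ℓ} → Decidable P → Dec (∃ P)
  any? {P} P? = map′ (λ (i , p) → from i , p) (λ (x , p) → to x , subst P (sym (strictlyInverseʳ x)) p)
                     (Fin.any? (P? ∘ from))

  ¬∀⇒∃¬ : {P : Pred A 0ℓ} → Decidable P → ¬ (∀ x → P x) → ∃ λ x → ¬ P x
  ¬∀⇒∃¬ {P} P? ¬∀P with Fin.¬∀⟶∃¬ size (P ∘ from) (P? ∘ from) (¬∀P ∘ ∀Fin⇒∀)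
  ... | i , ¬p = from i , ¬p

pigeonhole : {A B : Set} (finA : Finite A) (finB : Finite B) → Finite.size finB < Finite.size finA →
             (f : A → B) → ¬ Injective _≡_ _≡_ f
pigeonhole finA finB B<A f f-inj
  with Fin.pigeonhole B<A (Inverse.to (Finite.enum finB) ∘ f ∘ Inverse.from (Finite.enum finA))
... | i , j , i<j , eq = ℕ.<-irrefl (cong Fin.toℕ i≡j) i<j
  where
  i≡j : i ≡ j
  i≡j = FiniteProperties.from-injective finA (f-inj (FiniteProperties.to-injective finB eq))

missesPoint : {A B : Set} (finA : Finite A) (finB : Finite B) → Finite.size finA < Finite.size finB →
              (f : A → B) → ∃ λ y → ∀ x → f x ≢ y
missesPoint finA finB A<B f with ¬∀⇒∃¬ (λ y → any? (λ x → f x ≟ y)) ¬surjective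
  where
  open FiniteProperties finB using (¬∀⇒∃¬; _≟_)
  open FiniteProperties finA using (any?)
  ¬surjective : ¬ (∀ y → ∃ λ x → f x ≡ y)
  ¬surjective surj = pigeonhole finB finA A<B (proj₁ ∘ surj)
    (λ {y} {y'} eq → trans (sym (proj₂ (surj y))) (trans (cong f eq) (proj₂ (surj y'))))
... | y , ∄x = y , λ x fx≡y → ∄x (x , fx≡y)

finiteZ2 : Finite Z2
finiteZ2 = finite 2 (mk↔ₛ′ (λ { z2·0 → 0F ; z2·1 → 1F }) (λ { 0F → z2·0 ; 1F → z2·1 })
                           (λ { 0F → refl ; 1F → refl }) (λ { z2·0 → refl ; z2·1 → refl }))

finiteZ4 : Finite Z4
finiteZ4 = finite 4 (mk↔ₛ′ (λ { z4·0 → 0F ; z4·1 → 1F ; z4·2 → 2F ; z4·3 → 3F })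
                           (λ { 0F → z4·0 ; 1F → z4·1 ; 2F → z4·2 ; 3F → z4·3 })
                           (λ { 0F → refl ; 1F → refl ; 2F → refl ; 3F → refl })
                           (λ { z4·0 → refl ; z4·1 → refl ; z4·2 → refl ; z4·3 → refl }))

finiteVec : {A : Set} → Finite A → (n : ℕ) → Finite (Vec A n)
finiteVec (finite s e) n = finite (s ^ n)
  (↔-trans (↔-sym (Recursive.↔Vec n))
           (↔-trans (Recursive.lift↔ n e) (↔-sym (Recursive.Fin[m^n]↔Fin[m]^n s n))))

finite× : {A B : Set} → Finite A → Finite B → Finite (A × B)
finite× (finite s e) (finite t e') = finite (s * t) (↔-trans (×-cong e e') (↔-sym Fin.*↔×))

sameSize⇒sameOrder : (G H : Grp) (finG : Finite (Grp.Carrier G)) (finH : Finite (Grp.Carrier H)) →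
                     Finite.size finG ≡ Finite.size finH → SameOrder G H
sameSize⇒sameOrder G H (finite s e) (finite .s e') refl =
  _ , Bijection.bijective (↔⇒⤖ (↔-trans e (↔-sym e')))

infixl 7 _*4_
_*4_ : Z4 → Z4 → Z4
z4·0 *4 d = z4·0
z4·1 *4 d = d
z4·2 *4 d = d +4 d
z4·3 *4 d = neg4 d

infixr 7 _·₂_
_·₂_ : Z4 → Z2 → Z2
z4·0 ·₂ x = z2·0
z4·1 ·₂ x = x
z4·2 ·₂ x = z2·0
z4·3 ·₂ x = x

record Z4Module : Set₁ where
  field
    group : Grp
  open Grp group public
  infixr 7 _·_
  field
    _·_          : Z4 → Carrier → Carrier
    ∙-comm       : ∀ x y → x ∙ y ≡ y ∙ x
    +4-·-distrib : ∀ c d x → (c +4 d) · x ≡ (c · x) ∙ (d · x)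
    ·-∙-distrib  : ∀ d x y → d · (x ∙ y) ≡ (d · x) ∙ (d · y)
    *4-·-assoc   : ∀ c d x → c · (d · x) ≡ (c *4 d) · x
    1·x≡x        : ∀ x → z4·1 · x ≡ x

open FiniteProperties finiteZ2 using () renaming (_≟_ to _≟₂_; all? to ∀₂?)
open FiniteProperties finiteZ4 using () renaming (_≟_ to _≟₄_; all? to ∀₄?)

ℤ/2ᴹ : Z4Module
ℤ/2ᴹ = record
  { group = ℤ/2 ; _·_ = _·₂_
  ; ∙-comm       = from-yes (∀₂? λ x → ∀₂? λ y → (x +2 y) ≟₂ (y +2 x))
  ; +4-·-distrib = from-yes (∀₄? λ c → ∀₄? λ d → ∀₂? λ x →
                               ((c +4 d) ·₂ x) ≟₂ ((c ·₂ x) +2 (d ·₂ x)))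
  ; ·-∙-distrib  = from-yes (∀₄? λ d → ∀₂? λ x → ∀₂? λ y →
                               (d ·₂ (x +2 y)) ≟₂ ((d ·₂ x) +2 (d ·₂ y)))
  ; *4-·-assoc   = from-yes (∀₄? λ c → ∀₄? λ d → ∀₂? λ x → (c ·₂ d ·₂ x) ≟₂ ((c *4 d) ·₂ x))
  ; 1·x≡x        = λ x → refl
  }

ℤ/4ᴹ : Z4Module
ℤ/4ᴹ = record
  { group = ℤ/4 ; _·_ = _*4_
  ; ∙-comm       = from-yes (∀₄? λ x → ∀₄? λ y → (x +4 y) ≟₄ (y +4 x))
  ; +4-·-distrib = from-yes (∀₄? λ c → ∀₄? λ d → ∀₄? λ x →
                               ((c +4 d) *4 x) ≟₄ ((c *4 x) +4 (d *4 x)))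
  ; ·-∙-distrib  = from-yes (∀₄? λ d → ∀₄? λ x → ∀₄? λ y →
                               (d *4 (x +4 y)) ≟₄ ((d *4 x) +4 (d *4 y)))
  ; *4-·-assoc   = from-yes (∀₄? λ c → ∀₄? λ d → ∀₄? λ x → (c *4 (d *4 x)) ≟₄ (c *4 d *4 x))
  ; 1·x≡x        = λ x → refl
  }

infixl 8 _^ᴹ_
_^ᴹ_ : Z4Module → ℕ → Z4Module
M ^ᴹ n = record
  { group = group ^ᴳ n ; _·_ = λ d → map (d ·_)
  ; ∙-comm = comm
  ; +4-·-distrib = λ c d → distribʳ
  ; ·-∙-distrib = λ d → distribˡ
  ; *4-·-assoc = λ c d x → trans (sym (Vec.map-∘ (c ·_) (d ·_) x)) (Vec.map-cong (*4-·-assoc c d) x)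
  ; 1·x≡x = λ x → trans (Vec.map-cong 1·x≡x x) (Vec.map-id x)
  }
  where
  open Z4Module M
  open PowerOps group

  comm : ∀ {m} (x y : Vec Carrier m) → mulV x y ≡ mulV y x
  comm [] [] = refl
  comm (x ∷ xs) (y ∷ ys) = cong₂ _∷_ (∙-comm x y) (comm xs ys)

  distribʳ : ∀ {m c d} (x : Vec Carrier m) → map ((c +4 d) ·_) x ≡ mulV (map (c ·_) x) (map (d ·_) x)
  distribʳ [] = refl
  distribʳ {c = c} {d} (x ∷ xs) = cong₂ _∷_ (+4-·-distrib c d x) (distribʳ xs)

  distribˡ : ∀ {m d} (x y : Vec Carrier m) →
             map (d ·_) (mulV x y) ≡ mulV (map (d ·_) x) (map (d ·_) y)
  distribˡ [] [] = refl
  distribˡ {d = d} (x ∷ xs) (y ∷ ys) = cong₂ _∷_ (·-∙-distrib d x y) (distribˡ xs ys)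

infixr 2 _×ᴹ_
_×ᴹ_ : Z4Module → Z4Module → Z4Module
M ×ᴹ N = record
  { group = M.group ×ᴳ N.group ; _·_ = λ d (x , y) → d M.· x , d N.· y
  ; ∙-comm = λ (x , y) (x' , y') → cong₂ _,_ (M.∙-comm x x') (N.∙-comm y y')
  ; +4-·-distrib = λ c d (x , y) → cong₂ _,_ (M.+4-·-distrib c d x) (N.+4-·-distrib c d y)
  ; ·-∙-distrib = λ d (x , y) (x' , y') → cong₂ _,_ (M.·-∙-distrib d x x') (N.·-∙-distrib d y y')
  ; *4-·-assoc = λ c d (x , y) → cong₂ _,_ (M.*4-·-assoc c d x) (N.*4-·-assoc c d y)
  ; 1·x≡x = λ (x , y) → cong₂ _,_ (M.1·x≡x x) (N.1·x≡x y)
  }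
  where
  module M = Z4Module M
  module N = Z4Module N

ℤ/2ᵃ×ℤ/4ᵇ : ℕ → ℕ → Z4Module
ℤ/2ᵃ×ℤ/4ᵇ a b = ℤ/2ᴹ ^ᴹ a ×ᴹ ℤ/4ᴹ ^ᴹ b

finiteℤ/2ᵃ×ℤ/4ᵇ : ∀ a b → Finite (Z4Module.Carrier (ℤ/2ᵃ×ℤ/4ᵇ a b))
finiteℤ/2ᵃ×ℤ/4ᵇ a b = finite× (finiteVec finiteZ2 a) (finiteVec finiteZ4 b)

module _ {A : Set} where
  update-≡ : ∀ {k} (g : Vector A k) i x → (g [ i ≔ x ]) i ≡ x
  update-≡ g i x with i Fin.≟ i
  ... | yes _ = refl
  ... | no i≢i = ⊥-elim (i≢i refl)

  update-≢ : ∀ {k} (g : Vector A k) i x {j} → j ≢ i → (g [ i ≔ x ]) j ≡ g j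
  update-≢ g i x {j} j≢i with j Fin.≟ i
  ... | yes j≡i = ⊥-elim (j≢i j≡i)
  ... | no _ = refl

  update-tail : ∀ {k} (g : Vector A (suc k)) i x j → (g [ suc i ≔ x ]) (suc j) ≡ (tail g [ i ≔ x ]) j
  update-tail g i x j = by-cases (j Fin.≟ i)
    where
    by-cases : ∀ {j} → Dec (j ≡ i) → (g [ suc i ≔ x ]) (suc j) ≡ (tail g [ i ≔ x ]) j
    by-cases (yes refl) = trans (update-≡ g (suc i) x) (sym (update-≡ (tail g) i x))
    by-cases (no j≢i) =
      trans (update-≢ g (suc i) x (j≢i ∘ Fin.suc-injective)) (sym (update-≢ (tail g) i x j≢i))

infixl 6 _+ᶜ_
infixr 7 _·ᶜ_
_+ᶜ_ : ∀ {k} → Vec Z4 k → Vec Z4 k → Vec Z4 k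
_+ᶜ_ = zipWith _+4_

_·ᶜ_ : ∀ {k} → Z4 → Vec Z4 k → Vec Z4 k
d ·ᶜ c = map (d *4_) c

-ᶜ_ : ∀ {k} → Vec Z4 k → Vec Z4 k
-ᶜ c = z4·3 ·ᶜ c

0ᶜ : ∀ k → Vec Z4 k
0ᶜ k = replicate k z4·0

eᶜ : ∀ {k} → Fin k → Vec Z4 k
eᶜ i = 0ᶜ _ [ i ]≔ z4·1

module Z4ModuleProperties (M : Z4Module) where
  open Z4Module M public
  open ≡-Reasoning

  abelianGroup : AbelianGroup 0ℓ 0ℓ
  abelianGroup = record
    { isAbelianGroup = record
      { isGroup = record
        { isMonoid = record
          { isSemigroup = record { isMagma = isMagma _∙_ ; assoc = assoc }
          ; identity = identityˡ , identityʳ }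
        ; inverse = inverseˡ , inverseʳ
        ; ⁻¹-cong = cong _⁻¹ }
      ; comm = ∙-comm } }

  open AbelianGroupProperties abelianGroup public
    using (identityˡ-unique; inverseˡ-unique; x∙y⁻¹≈ε⇒x≈y; x≈y⇒x∙y⁻¹≈ε; //-rightDividesʳ)
  open CommutativeSemigroupProperties (AbelianGroup.commutativeSemigroup abelianGroup)
    using (interchange; x∙yz≈y∙xz)

  0·x≡ε : ∀ x → z4·0 · x ≡ ε
  0·x≡ε x = identityˡ-unique _ _ (sym (+4-·-distrib z4·0 z4·0 x))

  d·ε≡ε : ∀ d → d · ε ≡ ε
  d·ε≡ε d = identityˡ-unique _ _ (trans (sym (·-∙-distrib d ε ε)) (cong (d ·_) (identityˡ ε)))

  x∙x≡2·x : ∀ x → x ∙ x ≡ z4·2 · x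
  x∙x≡2·x x = trans (cong₂ _∙_ (sym (1·x≡x x)) (sym (1·x≡x x))) (sym (+4-·-distrib z4·1 z4·1 x))

  3·x≡x⁻¹ : ∀ x → z4·3 · x ≡ x ⁻¹
  3·x≡x⁻¹ x = inverseˡ-unique _ _ (begin
    (z4·3 · x) ∙ x              ≡⟨ cong ((z4·3 · x) ∙_) (1·x≡x x) ⟨
    (z4·3 · x) ∙ (z4·1 · x)     ≡⟨ +4-·-distrib z4·3 z4·1 x ⟨
    z4·0 · x                    ≡⟨ 0·x≡ε x ⟩
    ε                           ∎)

  lin : ∀ {k} → Vec Z4 k → Vector Carrier k → Carrier
  lin [] g = ε
  lin (d ∷ c) g = (d · g zero) ∙ lin c (tail g)

  lin-cong : ∀ {k} (c : Vec Z4 k) {g g'} → (∀ i → g i ≡ g' i) → lin c g ≡ lin c g'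
  lin-cong [] _ = refl
  lin-cong (d ∷ c) g≗g' = cong₂ _∙_ (cong (d ·_) (g≗g' zero)) (lin-cong c (g≗g' ∘ suc))

  lin-0ᶜ : ∀ {k} (g : Vector Carrier k) → lin (0ᶜ k) g ≡ ε
  lin-0ᶜ {zero} g = refl
  lin-0ᶜ {suc k} g = trans (cong₂ _∙_ (0·x≡ε _) (lin-0ᶜ (tail g))) (identityˡ ε)

  lin-eᶜ : ∀ {k} (i : Fin k) g → lin (eᶜ i) g ≡ g i
  lin-eᶜ zero g = trans (cong₂ _∙_ (1·x≡x _) (lin-0ᶜ (tail g))) (identityʳ _)
  lin-eᶜ (suc i) g = trans (cong₂ _∙_ (0·x≡ε _) (lin-eᶜ i (tail g))) (identityˡ _)

  lin-+ᶜ : ∀ {k} (c c' : Vec Z4 k) g → lin (c +ᶜ c') g ≡ lin c g ∙ lin c' g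
  lin-+ᶜ [] [] g = sym (identityˡ ε)
  lin-+ᶜ (d ∷ c) (d' ∷ c') g =
    trans (cong₂ _∙_ (+4-·-distrib d d' _) (lin-+ᶜ c c' (tail g))) (interchange _ _ _ _)

  lin-·ᶜ : ∀ {k} d (c : Vec Z4 k) g → lin (d ·ᶜ c) g ≡ d · lin c g
  lin-·ᶜ d [] g = sym (d·ε≡ε d)
  lin-·ᶜ d (d' ∷ c) g =
    trans (cong₂ _∙_ (sym (*4-·-assoc d d' _)) (lin-·ᶜ d c (tail g))) (sym (·-∙-distrib d _ _))

  lin--ᶜ : ∀ {k} (c : Vec Z4 k) g → lin (-ᶜ c) g ≡ lin c g ⁻¹
  lin--ᶜ c g = trans (lin-·ᶜ z4·3 c g) (3·x≡x⁻¹ _)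

  lin-∙⁻¹ : ∀ {k} (c c' : Vec Z4 k) g → lin (c +ᶜ -ᶜ c') g ≡ lin c g ∙ (lin c' g ⁻¹)
  lin-∙⁻¹ c c' g = trans (lin-+ᶜ c (-ᶜ c') g) (cong (lin c g ∙_) (lin--ᶜ c' g))

  lin-∷-ε : ∀ {k d x} (c : Vec Z4 k) g → d · x ≡ ε → lin (d ∷ c) (x ∷ᶠ g) ≡ lin c g
  lin-∷-ε c g d·x≡ε = trans (cong (_∙ lin c g) d·x≡ε) (identityˡ _)

  lin-absorb : ∀ {k} d (c c₀ : Vec Z4 k) g → lin (d ∷ c) (lin c₀ g ∷ᶠ g) ≡ lin (d ·ᶜ c₀ +ᶜ c) g
  lin-absorb d c c₀ g = sym (trans (lin-+ᶜ (d ·ᶜ c₀) c g) (cong (_∙ lin c g) (lin-·ᶜ d c₀ g)))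

  lin-translate : ∀ {k} d (c c₀ : Vec Z4 k) x g →
                  lin (d ∷ c) ((x ∙ lin c₀ g) ∷ᶠ g) ≡ lin (d ∷ (d ·ᶜ c₀ +ᶜ c)) (x ∷ᶠ g)
  lin-translate d c c₀ x g = begin
    (d · (x ∙ lin c₀ g)) ∙ lin c g            ≡⟨ cong (_∙ lin c g) (·-∙-distrib d x _) ⟩
    ((d · x) ∙ (d · lin c₀ g)) ∙ lin c g      ≡⟨ assoc _ _ _ ⟩
    (d · x) ∙ ((d · lin c₀ g) ∙ lin c g)      ≡⟨ cong ((d · x) ∙_) (lin-absorb d c c₀ g) ⟩
    (d · x) ∙ lin (d ·ᶜ c₀ +ᶜ c) g            ∎

  lin-update : ∀ {k} (c : Vec Z4 k) g i x →
               lin c (g [ i ≔ x ]) ≡ lin (lookup c i ∷ (c [ i ]≔ z4·0)) (x ∷ᶠ g)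
  lin-update (d ∷ c) g zero x = begin
    (d · (g [ zero ≔ x ]) zero) ∙ lin c (tail (g [ zero ≔ x ]))
      ≡⟨ cong₂ (λ y z → (d · y) ∙ z) (update-≡ g zero x) (lin-cong c λ j → update-≢ g zero x λ ()) ⟩
    (d · x) ∙ lin c (tail g)
      ≡⟨ cong ((d · x) ∙_) (lin-∷-ε c (tail g) (0·x≡ε (g zero))) ⟨
    (d · x) ∙ lin (z4·0 ∷ c) g ∎
  lin-update (d ∷ c) g (suc i) x = begin
    (d · (g [ suc i ≔ x ]) zero) ∙ lin c (tail (g [ suc i ≔ x ]))
      ≡⟨ cong₂ (λ y z → (d · y) ∙ z) (update-≢ g (suc i) x λ ()) (lin-cong c (update-tail g i x)) ⟩
    (d · g zero) ∙ lin c (tail g [ i ≔ x ])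
      ≡⟨ cong ((d · g zero) ∙_) (lin-update c (tail g) i x) ⟩
    (d · g zero) ∙ ((lookup c i · x) ∙ lin (c [ i ]≔ z4·0) (tail g))
      ≡⟨ x∙yz≈y∙xz _ _ _ ⟩
    (lookup c i · x) ∙ ((d · g zero) ∙ lin (c [ i ]≔ z4·0) (tail g)) ∎

  ·∈Gen : ∀ {k} {g : Vector Carrier k} {x} d → Gen group g x → Gen group g (d · x)
  ·∈Gen {x = x} z4·0 p = subst (Gen group _) (sym (0·x≡ε x)) one
  ·∈Gen {x = x} z4·1 p = subst (Gen group _) (sym (1·x≡x x)) p
  ·∈Gen {x = x} z4·2 p = subst (Gen group _) (x∙x≡2·x x) (mul p p)
  ·∈Gen {x = x} z4·3 p = subst (Gen group _) (sym (3·x≡x⁻¹ x)) (inv p)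

  tail⊆Gen : ∀ {k} {g : Vector Carrier (suc k)} {x} → Gen group (tail g) x → Gen group g x
  tail⊆Gen (gen i) = gen (suc i)
  tail⊆Gen one = one
  tail⊆Gen (mul p q) = mul (tail⊆Gen p) (tail⊆Gen q)
  tail⊆Gen (inv p) = inv (tail⊆Gen p)

  lin∈Gen : ∀ {k} (c : Vec Z4 k) g → Gen group g (lin c g)
  lin∈Gen [] g = one
  lin∈Gen (d ∷ c) g = mul (·∈Gen d (gen zero)) (tail⊆Gen (lin∈Gen c (tail g)))

  coefficients : ∀ {k} {g : Vector Carrier k} {x} → Gen group g x → Vec Z4 k
  coefficients (gen i) = eᶜ i
  coefficients one = 0ᶜ _
  coefficients (mul p q) = coefficients p +ᶜ coefficients q
  coefficients (inv p) = -ᶜ coefficients p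

  lin-coefficients : ∀ {k} {g : Vector Carrier k} {x} (p : Gen group g x) → lin (coefficients p) g ≡ x
  lin-coefficients {g = g} (gen i) = lin-eᶜ i g
  lin-coefficients {g = g} one = lin-0ᶜ g
  lin-coefficients {g = g} (mul p q) =
    trans (lin-+ᶜ (coefficients p) (coefficients q) g) (cong₂ _∙_ (lin-coefficients p) (lin-coefficients q))
  lin-coefficients {g = g} (inv p) = trans (lin--ᶜ (coefficients p) g) (cong _⁻¹ (lin-coefficients p))

  InSpan : ∀ {k} → Vector Carrier k → Pred Carrier 0ℓ
  InSpan g x = ∃ λ c → lin c g ≡ x

  ∉Span⇒∙lin≢ε : ∀ {k} {g : Vector Carrier k} {x} → ¬ InSpan g x → ∀ c → x ∙ lin c g ≢ ε
  ∉Span⇒∙lin≢ε {g = g} {x} x∉ c eq = x∉ (-ᶜ c , trans (lin--ᶜ c g) (sym (inverseˡ-unique x _ eq)))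

  Even : Pred Carrier 0ℓ
  Even z = ∃ λ w → z4·2 · w ≡ z

  Even-2· : ∀ w → Even (z4·2 · w)
  Even-2· w = w , refl

  Even-ε : Even ε
  Even-ε = ε , d·ε≡ε z4·2

  Even-∙ : ∀ {p q} → Even p → Even q → Even (p ∙ q)
  Even-∙ (w , refl) (w' , refl) = w ∙ w' , ·-∙-distrib z4·2 w w'

  Even-· : ∀ d {z} → Even z → Even (d · z)
  Even-· d (w , refl) = d · w , (begin
    z4·2 · (d · w)       ≡⟨ *4-·-assoc z4·2 d w ⟩
    (z4·2 *4 d) · w      ≡⟨ cong (_· w) (2*d≡d*2 d) ⟩
    (d *4 z4·2) · w      ≡⟨ *4-·-assoc d z4·2 w ⟨
    d · (z4·2 · w)       ∎)
    where
    2*d≡d*2 : ∀ d → z4·2 *4 d ≡ d *4 z4·2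
    2*d≡d*2 z4·0 = refl
    2*d≡d*2 z4·1 = refl
    2*d≡d*2 z4·2 = refl
    2*d≡d*2 z4·3 = refl

  Even-cancelˡ : ∀ {p q} → Even p → Even (p ∙ q) → Even q
  Even-cancelˡ {p} {q} ev-p ev-pq = subst Even (//-rightDividesʳ p q)
    (Even-∙ (subst Even (∙-comm p q) ev-pq) (subst Even (3·x≡x⁻¹ p) (Even-· z4·3 ev-p)))

  Even-∙⇔ : ∀ {p q} → Even p → Even (p ∙ q) ⇔ Even q
  Even-∙⇔ ev-p = mk⇔ (Even-cancelˡ ev-p) (Even-∙ ev-p)

  2·even≡ε : ∀ {z} → Even z → z4·2 · z ≡ ε
  2·even≡ε (w , refl) = trans (*4-·-assoc z4·2 z4·2 w) (0·x≡ε w)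

  3·even≡even : ∀ {z} → Even z → z4·3 · z ≡ z
  3·even≡even (w , refl) = *4-·-assoc z4·3 z4·2 w

  OddModulo : ∀ {k} → Vector Carrier k → Pred Carrier 0ℓ
  OddModulo g x = ∀ c → ¬ Even (x ∙ lin c g)

  oddModulo-1· : ∀ {k} {g : Vector Carrier k} {x} → OddModulo g x → ∀ c → ¬ Even ((z4·1 · x) ∙ lin c g)
  oddModulo-1· {x = x} odd c = odd c ∘ subst Even (cong (_∙ _) (1·x≡x x))

  oddModulo-3· : ∀ {k} {g : Vector Carrier k} {x} → OddModulo g x → ∀ c → ¬ Even ((z4·3 · x) ∙ lin c g)
  oddModulo-3· {g = g} {x} odd c ev = odd (-ᶜ c) (subst Even 3·[3·x∙lin] (Even-· z4·3 ev))
    where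
    3·[3·x∙lin] : z4·3 · ((z4·3 · x) ∙ lin c g) ≡ x ∙ lin (-ᶜ c) g
    3·[3·x∙lin] = begin
      z4·3 · ((z4·3 · x) ∙ lin c g)            ≡⟨ ·-∙-distrib z4·3 _ _ ⟩
      (z4·3 · (z4·3 · x)) ∙ (z4·3 · lin c g)   ≡⟨ cong₂ _∙_ (trans (*4-·-assoc z4·3 z4·3 x) (1·x≡x x))
                                                             (sym (lin-·ᶜ z4·3 c g)) ⟩
      x ∙ lin (-ᶜ c) g                         ∎

module Alikeness (M N : Z4Module) where
  private
    module M = Z4ModuleProperties M
    module N = Z4ModuleProperties N

  Alike : M.Carrier → N.Carrier → Set
  Alike p q = (p ≡ M.ε ⇔ q ≡ N.ε) × (M.Even p ⇔ N.Even q)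

  AlikeTuples : ∀ {k} → Vector M.Carrier k → Vector N.Carrier k → Set
  AlikeTuples g h = ∀ c → Alike (M.lin c g) (N.lin c h)

  Extensible : ℕ → Set
  Extensible k = ∀ {g : Vector M.Carrier k} {h : Vector N.Carrier k} →
                 AlikeTuples g h → ∀ x → ∃ λ y → AlikeTuples (x ∷ᶠ g) (y ∷ᶠ h)

  ¬Even⇒alike : ∀ {p q} → ¬ M.Even p → ¬ N.Even q → Alike p q
  ¬Even⇒alike ¬ev-p ¬ev-q =
    both-false (λ { refl → ¬ev-p M.Even-ε }) (λ { refl → ¬ev-q N.Even-ε }) , both-false ¬ev-p ¬ev-q
    where
    both-false : ∀ {P Q : Set} → ¬ P → ¬ Q → P ⇔ Q
    both-false ¬P ¬Q = mk⇔ (⊥-elim ∘ ¬P) (⊥-elim ∘ ¬Q)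

  alike-∷ : ∀ {k} {g : Vector M.Carrier k} {h : Vector N.Carrier k} {d x y p q} c →
            d M.· x ≡ p → d N.· y ≡ q → Alike (p M.∙ M.lin c g) (q N.∙ N.lin c h) →
            Alike (M.lin (d ∷ c) (x ∷ᶠ g)) (N.lin (d ∷ c) (y ∷ᶠ h))
  alike-∷ c refl refl p∼q = p∼q

  alike-∷-ε : ∀ {k} {g : Vector M.Carrier k} {h : Vector N.Carrier k} {d x y} c →
              d M.· x ≡ M.ε → d N.· y ≡ N.ε → Alike (M.lin c g) (N.lin c h) →
              Alike (M.lin (d ∷ c) (x ∷ᶠ g)) (N.lin (d ∷ c) (y ∷ᶠ h))
  alike-∷-ε {g = g} {h} c d·x≡ε d·y≡ε =
    subst₂ Alike (sym (M.lin-∷-ε c g d·x≡ε)) (sym (N.lin-∷-ε c h d·y≡ε))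

  module _ {k} {g : Vector M.Carrier k} {h : Vector N.Carrier k} (g∼h : AlikeTuples g h) where

    lin-≡⇔ : ∀ c c' → M.lin c g ≡ M.lin c' g ⇔ N.lin c h ≡ N.lin c' h
    lin-≡⇔ c c' = mk⇔
      (λ eq → N.x∙y⁻¹≈ε⇒x≈y _ _ (trans (sym (N.lin-∙⁻¹ c c' h))
                (Equivalence.to difference-zero (trans (M.lin-∙⁻¹ c c' g) (M.x≈y⇒x∙y⁻¹≈ε eq)))))
      (λ eq → M.x∙y⁻¹≈ε⇒x≈y _ _ (trans (sym (M.lin-∙⁻¹ c c' g))
                (Equivalence.from difference-zero (trans (N.lin-∙⁻¹ c c' h) (N.x≈y⇒x∙y⁻¹≈ε eq)))))
      where
      difference-zero : M.lin (c +ᶜ -ᶜ c') g ≡ M.ε ⇔ N.lin (c +ᶜ -ᶜ c') h ≡ N.ε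
      difference-zero = proj₁ (g∼h (c +ᶜ -ᶜ c'))

    alike⇒extendsToIso : ExtendsToIso M.group N.group g h
    alike⇒extendsToIso = record
      { φ = λ (x , p) → N.lin (M.coefficients p) h
      ; φ-wd = λ (x , p) (x' , p') x≡x' → Equivalence.to (lin-≡⇔ (M.coefficients p) (M.coefficients p'))
                 (trans (M.lin-coefficients p) (trans x≡x' (sym (M.lin-coefficients p'))))
      ; φ-into = λ (x , p) → N.lin∈Gen (M.coefficients p) h
      ; φ-hom = λ (x , p) (x' , p') → N.lin-+ᶜ (M.coefficients p) (M.coefficients p') h
      ; φ-inj = λ (x , p) (x' , p') eq → trans (sym (M.lin-coefficients p))
                  (trans (Equivalence.from (lin-≡⇔ (M.coefficients p) (M.coefficients p')) eq)
                         (M.lin-coefficients p'))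
      ; φ-surj = λ y q → let c = N.coefficients q in
                   (M.lin c g , M.lin∈Gen c g) ,
                   trans (Equivalence.to (lin-≡⇔ (M.coefficients (M.lin∈Gen c g)) c)
                                         (M.lin-coefficients (M.lin∈Gen c g)))
                         (N.lin-coefficients q)
      ; φ-ext = λ i → N.lin-eᶜ i h
      }

    extend-inSpan : ∀ c₀ → AlikeTuples (M.lin c₀ g ∷ᶠ g) (N.lin c₀ h ∷ᶠ h)
    extend-inSpan c₀ (d ∷ c) =
      subst₂ Alike (sym (M.lin-absorb d c c₀ g)) (sym (N.lin-absorb d c c₀ h)) (g∼h (d ·ᶜ c₀ +ᶜ c))

    extend-even : ∀ {x y} → M.Even x → N.Even y → ¬ M.InSpan g x → ¬ N.InSpan h y →
                  AlikeTuples (x ∷ᶠ g) (y ∷ᶠ h)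
    extend-even {x} {y} ev-x ev-y x∉ y∉ = λ where
        (z4·0 ∷ c) → alike-∷-ε c (M.0·x≡ε x) (N.0·x≡ε y) (g∼h c)
        (z4·1 ∷ c) → alike-∷ c (M.1·x≡x x) (N.1·x≡x y) (shifted c)
        (z4·2 ∷ c) → alike-∷-ε c (M.2·even≡ε ev-x) (N.2·even≡ε ev-y) (g∼h c)
        (z4·3 ∷ c) → alike-∷ c (M.3·even≡even ev-x) (N.3·even≡even ev-y) (shifted c)
      where
      shifted : ∀ c → Alike (x M.∙ M.lin c g) (y N.∙ N.lin c h)
      shifted c = mk⇔ (⊥-elim ∘ M.∉Span⇒∙lin≢ε x∉ c) (⊥-elim ∘ N.∉Span⇒∙lin≢ε y∉ c) ,
                  ⇔.trans (M.Even-∙⇔ ev-x) (⇔.trans (proj₂ (g∼h c)) (⇔.sym (N.Even-∙⇔ ev-y)))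

    extend-odd : ∀ {x y} → M.OddModulo g x → N.OddModulo h y →
                 AlikeTuples ((z4·2 M.· x) ∷ᶠ g) ((z4·2 N.· y) ∷ᶠ h) → AlikeTuples (x ∷ᶠ g) (y ∷ᶠ h)
    extend-odd {x} {y} odd-x odd-y 2x∼2y = λ where
      (z4·0 ∷ c) → alike-∷-ε c (M.0·x≡ε x) (N.0·x≡ε y) (g∼h c)
      (z4·1 ∷ c) → ¬Even⇒alike (M.oddModulo-1· odd-x c) (N.oddModulo-1· odd-y c)
      (z4·2 ∷ c) → alike-∷ c (sym (M.1·x≡x _)) (sym (N.1·x≡x _)) (2x∼2y (z4·1 ∷ c))
      (z4·3 ∷ c) → ¬Even⇒alike (M.oddModulo-3· odd-x c) (N.oddModulo-3· odd-y c)

  extend-translate : ∀ {k} {g : Vector M.Carrier k} {h : Vector N.Carrier k} {x y} →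
                     AlikeTuples (x ∷ᶠ g) (y ∷ᶠ h) →
                     ∀ c₀ → AlikeTuples ((x M.∙ M.lin c₀ g) ∷ᶠ g) ((y N.∙ N.lin c₀ h) ∷ᶠ h)
  extend-translate {g = g} {h} {x} {y} xg∼yh c₀ (d ∷ c) =
    subst₂ Alike (sym (M.lin-translate d c c₀ x g)) (sym (N.lin-translate d c c₀ y h))
           (xg∼yh (d ∷ (d ·ᶜ c₀ +ᶜ c)))

  alike-update : ∀ {k} {g : Vector M.Carrier k} {h : Vector N.Carrier k} {x y} →
                 AlikeTuples (x ∷ᶠ g) (y ∷ᶠ h) → ∀ i → AlikeTuples (g [ i ≔ x ]) (h [ i ≔ y ])
  alike-update {g = g} {h} {x} {y} xg∼yh i c =
    subst₂ Alike (sym (M.lin-update c g i x)) (sym (N.lin-update c h i y))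
           (xg∼yh (lookup c i ∷ (c [ i ]≔ z4·0)))

  alike-[] : {g : Vector M.Carrier 0} {h : Vector N.Carrier 0} → AlikeTuples g h
  alike-[] [] = mk⇔ (λ _ → refl) (λ _ → refl) , mk⇔ (λ _ → N.Even-ε) (λ _ → M.Even-ε)

alike-sym : ∀ {M N k} {g : Vector (Z4Module.Carrier M) k} {h : Vector (Z4Module.Carrier N) k} →
            Alikeness.AlikeTuples M N g h → Alikeness.AlikeTuples N M h g
alike-sym g∼h c = ⇔.sym (proj₁ (g∼h c)) , ⇔.sym (proj₂ (g∼h c))

module _ {M N : Z4Module} {k : ℕ} (forth : Alikeness.Extensible M N k) (back : Alikeness.Extensible N M k)
  where
  open Alikeness M N

  alike⇒sameColor : ∀ t {g h} → AlikeTuples g h → SameColor (Z4Module.group M) (Z4Module.group N) t g h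
  alike⇒sameColor zero g∼h = alike⇒extendsToIso g∼h
  alike⇒sameColor (suc t) g∼h = alike⇒sameColor t g∼h ,
    (λ x → let y , xg∼yh = forth g∼h x in y , λ i → alike⇒sameColor t (alike-update xg∼yh i)) ,
    (λ y → let x , yh∼xg = back (alike-sym {M} {N} g∼h) y
           in x , λ i → alike⇒sameColor t (alike-update (alike-sym {N} {M} yh∼xg) i))

half : Z4 → Z2
half z4·0 = z2·0
half z4·1 = z2·0
half z4·2 = z2·1
half z4·3 = z2·1

embed : Z2 → Z4
embed z2·0 = z4·0
embed z2·1 = z4·1

module ℤ/2ᵃ×ℤ/4ᵇ-Properties (a b : ℕ) where
  open Z4ModuleProperties (ℤ/2ᵃ×ℤ/4ᵇ a b) public

  halfOfDouble : Carrier → Vec Z2 b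
  halfOfDouble z = map half (proj₂ (z4·2 · z))

  halfOfDouble-embed : ∀ u w → halfOfDouble (u , map embed w) ≡ w
  halfOfDouble-embed u w =
    trans (sym (Vec.map-∘ half (z4·2 *4_) (map embed w)))
          (trans (sym (Vec.map-∘ (half ∘ (z4·2 *4_)) embed w))
                 (trans (Vec.map-cong (λ { z2·0 → refl ; z2·1 → refl }) w) (Vec.map-id w)))

  proj₁-2·≡ε : ∀ z → proj₁ (z4·2 · z) ≡ proj₁ ε
  proj₁-2·≡ε (u , v) = 2·u≡ε u
    where
    2·u≡ε : ∀ {n} (u : Vec Z2 n) → map (z4·2 ·₂_) u ≡ PowerOps.oneV ℤ/2 n
    2·u≡ε [] = refl
    2·u≡ε (x ∷ u) = cong (z2·0 ∷_) (2·u≡ε u)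

  doubles-determined : ∀ {z z'} → halfOfDouble z ≡ halfOfDouble z' → z4·2 · z ≡ z4·2 · z'
  doubles-determined {z} {z'} eq = cong₂ _,_ (trans (proj₁-2·≡ε z) (sym (proj₁-2·≡ε z')))
    (trans (2·v≡2·embed[half[2·v]] (proj₂ z))
           (trans (cong (map (z4·2 *4_) ∘ map embed) eq) (sym (2·v≡2·embed[half[2·v]] (proj₂ z')))))
    where
    2·v≡2·embed[half[2·v]] : ∀ {n} (v : Vec Z4 n) →
                             map (z4·2 *4_) v ≡ map (z4·2 *4_) (map embed (map half (map (z4·2 *4_) v)))
    2·v≡2·embed[half[2·v]] [] = refl
    2·v≡2·embed[half[2·v]] (x ∷ v) = cong₂ _∷_ (pointwise x) (2·v≡2·embed[half[2·v]] v)
      where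
      pointwise : ∀ x → z4·2 *4 x ≡ z4·2 *4 embed (half (z4·2 *4 x))
      pointwise z4·0 = refl
      pointwise z4·1 = refl
      pointwise z4·2 = refl
      pointwise z4·3 = refl

  2·-ignores-proj₁ : ∀ u u' v → z4·2 · (u , v) ≡ z4·2 · (u' , v)
  2·-ignores-proj₁ u u' v = doubles-determined refl

  even⇒proj₁≡ε : ∀ {z} → Even z → proj₁ z ≡ proj₁ ε
  even⇒proj₁≡ε (w , refl) = proj₁-2·≡ε w

module _ {a b a' b' : ℕ} where
  private
    module M = ℤ/2ᵃ×ℤ/4ᵇ-Properties a b
    module N = ℤ/2ᵃ×ℤ/4ᵇ-Properties a' b'

  -- Doubling a section of f injects 2N, of size 2^b', into 2M, of size 2^b.
  ¬surjectiveHom : b < b' → (f : M.Carrier → N.Carrier) → (∀ x y → f (x M.∙ y) ≡ f x N.∙ f y) →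
                   ¬ (∀ y → ∃ λ x → f x ≡ y)
  ¬surjectiveHom b<b' f hom surj =
    pigeonhole (finiteVec finiteZ2 b') (finiteVec finiteZ2 b) (ℕ.^-monoʳ-< 2 (s≤s (s≤s z≤n)) b<b')
               θ θ-injective
    where
    open ≡-Reasoning

    s : N.Carrier → M.Carrier
    s = proj₁ ∘ surj

    lifted : Vec Z2 b' → N.Carrier
    lifted w = proj₁ N.ε , map embed w

    θ : Vec Z2 b' → Vec Z2 b
    θ w = M.halfOfDouble (s (lifted w))

    f-2· : ∀ x → f (z4·2 M.· x) ≡ z4·2 N.· f x
    f-2· x = trans (cong f (sym (M.x∙x≡2·x x))) (trans (hom x x) (N.x∙x≡2·x (f x)))

    θ-injective : Injective _≡_ _≡_ θ
    θ-injective {w} {w'} θw≡θw' = begin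
      w                             ≡⟨ N.halfOfDouble-embed (proj₁ N.ε) w ⟨
      N.halfOfDouble (lifted w)     ≡⟨ cong (map half ∘ proj₂) 2·lifted-w≡2·lifted-w' ⟩
      N.halfOfDouble (lifted w')    ≡⟨ N.halfOfDouble-embed (proj₁ N.ε) w' ⟩
      w'                            ∎
      where
      2·lifted-w≡2·lifted-w' : z4·2 N.· lifted w ≡ z4·2 N.· lifted w'
      2·lifted-w≡2·lifted-w' = begin
        z4·2 N.· lifted w             ≡⟨ cong (z4·2 N.·_) (proj₂ (surj (lifted w))) ⟨
        z4·2 N.· f (s (lifted w))     ≡⟨ f-2· _ ⟨
        f (z4·2 M.· s (lifted w))     ≡⟨ cong f (M.doubles-determined θw≡θw') ⟩
        f (z4·2 M.· s (lifted w'))    ≡⟨ f-2· _ ⟩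
        z4·2 N.· f (s (lifted w'))    ≡⟨ cong (z4·2 N.·_) (proj₂ (surj (lifted w'))) ⟩
        z4·2 N.· lifted w'            ∎

  ℤ/4-rank<⇒≇ : b < b' → ¬ (M.group ≅ N.group)
  ℤ/4-rank<⇒≇ b<b' (f , hom , _ , surj) =
    ¬surjectiveHom b<b' f hom (λ y → proj₁ (surj y) , proj₂ (surj y) refl)

2[1+k]<⇒2k< : ∀ {k m} → 2 * suc k < m → 2 * k < m
2[1+k]<⇒2k< {k} = ℕ.<-trans (ℕ.*-monoʳ-< 2 (ℕ.n<1+n k))

4^k<2^m : ∀ {k m} → 2 * k < m → 4 ^ k < 2 ^ m
4^k<2^m {k} {m} 2k<m = subst (_< 2 ^ m) (sym (ℕ.^-*-assoc 2 2 k)) (ℕ.^-monoʳ-< 2 (s≤s (s≤s z≤n)) 2k<m)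

module Extension (M : Z4Module) (finite-M : Finite (Z4Module.Carrier M)) (a b : ℕ) where
  private
    module M = Z4ModuleProperties M
    module N = ℤ/2ᵃ×ℤ/4ᵇ-Properties a b
    open FiniteProperties finite-M using (_≟_)
  open Alikeness M (ℤ/2ᵃ×ℤ/4ᵇ a b)

  module _ {k} (2k<a : 2 * k < a) (2k<b : 2 * k < b)
           {g : Vector M.Carrier k} {h : Vector N.Carrier k} (g∼h : AlikeTuples g h) where
    private
      finiteCoefficients : Finite (Vec Z4 k)
      finiteCoefficients = finiteVec finiteZ4 k

      fresh₁ : ∃ λ u → ∀ c → proj₁ (N.lin c h) ≢ u
      fresh₁ = missesPoint finiteCoefficients (finiteVec finiteZ2 a) (4^k<2^m {k} 2k<a)
                           (λ c → proj₁ (N.lin c h))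

      fresh₂ : ∃ λ w → ∀ c → map half (proj₂ (N.lin c h)) ≢ w
      fresh₂ = missesPoint finiteCoefficients (finiteVec finiteZ2 b) (4^k<2^m {k} 2k<b)
                           (λ c → map half (proj₂ (N.lin c h)))

      u : Vec Z2 a
      u = proj₁ fresh₁

      w : Vec Z2 b
      w = proj₁ fresh₂

      oddModulo-u : ∀ v → N.OddModulo h (u , v)
      oddModulo-u v c ev = proj₂ fresh₁ (-ᶜ c) (begin
        proj₁ (N.lin (-ᶜ c) h)      ≡⟨ cong proj₁ (N.lin--ᶜ c h) ⟩
        proj₁ (N.lin c h N.⁻¹)      ≡⟨ ℤ/2ᵃ.inverseˡ-unique u _ (N.even⇒proj₁≡ε ev) ⟨
        u                           ∎)
        where
        open ≡-Reasoning
        module ℤ/2ᵃ = Z4ModuleProperties (ℤ/2ᴹ ^ᴹ a)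

      2·w∉Span : ∀ u' → ¬ N.InSpan h (z4·2 N.· (u' , map embed w))
      2·w∉Span u' (c , eq) =
        proj₂ fresh₂ c (trans (cong (map half ∘ proj₂) eq) (N.halfOfDouble-embed u' w))

      inSpan? : ∀ x → Dec (M.InSpan g x)
      inSpan? x = FiniteProperties.any? finiteCoefficients (λ c → M.lin c g ≟ x)

      evenCoset? : ∀ x → Dec (∃ λ c → M.Even (x M.∙ M.lin c g))
      evenCoset? x = FiniteProperties.any? finiteCoefficients λ c →
                       FiniteProperties.any? finite-M λ w → (z4·2 M.· w) ≟ (x M.∙ M.lin c g)

      extend-evenCoset : ∀ {x} → ¬ M.InSpan g x → ∀ c → M.Even (x M.∙ M.lin c g) →
                         ∃ λ y → AlikeTuples (x ∷ᶠ g) (y ∷ᶠ h)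
      extend-evenCoset {x} x∉ c ev = y N.∙ N.lin (-ᶜ c) h ,
          subst (λ x' → AlikeTuples (x' ∷ᶠ g) ((y N.∙ N.lin (-ᶜ c) h) ∷ᶠ h)) x∙lin∙lin⁻¹≡x translated
        where
        y : N.Carrier
        y = z4·2 N.· (proj₁ N.ε , map embed w)

        x∙lin∉ : ¬ M.InSpan g (x M.∙ M.lin c g)
        x∙lin∉ (c' , eq) = x∉ (c' +ᶜ -ᶜ c ,
          trans (M.lin-∙⁻¹ c' c g)
                (trans (cong (M._∙ (M.lin c g M.⁻¹)) eq) (M.//-rightDividesʳ (M.lin c g) x)))

        translated : AlikeTuples (((x M.∙ M.lin c g) M.∙ M.lin (-ᶜ c) g) ∷ᶠ g)
                                 ((y N.∙ N.lin (-ᶜ c) h) ∷ᶠ h)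
        translated = extend-translate
          (extend-even g∼h ev (N.Even-2· (proj₁ N.ε , map embed w)) x∙lin∉ (2·w∉Span (proj₁ N.ε)))
          (-ᶜ c)

        x∙lin∙lin⁻¹≡x : (x M.∙ M.lin c g) M.∙ M.lin (-ᶜ c) g ≡ x
        x∙lin∙lin⁻¹≡x =
          trans (cong ((x M.∙ M.lin c g) M.∙_) (M.lin--ᶜ c g)) (M.//-rightDividesʳ (M.lin c g) x)

      extend-odd-2·∈Span : ∀ {x} → M.OddModulo g x → M.InSpan g (z4·2 M.· x) →
                           ∃ λ y → AlikeTuples (x ∷ᶠ g) (y ∷ᶠ h)
      extend-odd-2·∈Span {x} odd (c , lin≡2x) = y , extend-odd g∼h odd (oddModulo-u v) 2x∼2y
        where
        lin-even : N.Even (N.lin c h)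
        lin-even = Equivalence.to (proj₂ (g∼h c)) (subst M.Even (sym lin≡2x) (M.Even-2· x))

        v : Vec Z4 b
        v = proj₂ (proj₁ lin-even)

        y : N.Carrier
        y = u , v

        2y≡lin : z4·2 N.· y ≡ N.lin c h
        2y≡lin = trans (N.2·-ignores-proj₁ u (proj₁ (proj₁ lin-even)) v) (proj₂ lin-even)

        2x∼2y : AlikeTuples ((z4·2 M.· x) ∷ᶠ g) ((z4·2 N.· y) ∷ᶠ h)
        2x∼2y = subst₂ (λ p q → AlikeTuples (p ∷ᶠ g) (q ∷ᶠ h)) lin≡2x (sym 2y≡lin) (extend-inSpan g∼h c)

      extend-odd-2·∉Span : ∀ {x} → M.OddModulo g x → ¬ M.InSpan g (z4·2 M.· x) →
                           ∃ λ y → AlikeTuples (x ∷ᶠ g) (y ∷ᶠ h)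
      extend-odd-2·∉Span {x} odd 2x∉ =
        y , extend-odd g∼h odd (oddModulo-u (map embed w))
                       (extend-even g∼h (M.Even-2· x) (N.Even-2· y) 2x∉ (2·w∉Span u))
        where
        y : N.Carrier
        y = u , map embed w

    extend : ∀ x → ∃ λ y → AlikeTuples (x ∷ᶠ g) (y ∷ᶠ h)
    extend x with inSpan? x
    ... | yes (c , refl) = N.lin c h , extend-inSpan g∼h c
    ... | no x∉ with evenCoset? x
    ...   | yes (c , ev) = extend-evenCoset x∉ c ev
    ...   | no ¬even with inSpan? (z4·2 M.· x)
    ...     | yes 2x∈ = extend-odd-2·∈Span (λ c ev → ¬even (c , ev)) 2x∈
    ...     | no 2x∉ = extend-odd-2·∉Span (λ c ev → ¬even (c , ev)) 2x∉

  alikePartner : ∀ {k} → 2 * k < a → 2 * k < b → (g : Vector M.Carrier k) → ∃ λ h → AlikeTuples g h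
  alikePartner {zero} _ _ g = (λ ()) , alike-[]
  -- g zero ∷ᶠ tail g is g only up to η, which lin sees once the coefficients are a cons.
  alikePartner {suc k} 2k<a 2k<b g
    with h , g∼h ← alikePartner (2[1+k]<⇒2k< 2k<a) (2[1+k]<⇒2k< 2k<b) (tail g)
    with y , xg∼yh ← extend (2[1+k]<⇒2k< 2k<a) (2[1+k]<⇒2k< 2k<b) g∼h (g zero)
    = y ∷ᶠ h , λ { (d ∷ c) → xg∼yh (d ∷ c) }

notDistinguished : ∀ {a b a' b' k} → 2 * k < a → 2 * k < b → 2 * k < a' → 2 * k < b' → ∀ t →
                   SameColorSets k (Z4Module.group (ℤ/2ᵃ×ℤ/4ᵇ a b))
                                   (Z4Module.group (ℤ/2ᵃ×ℤ/4ᵇ a' b')) t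
notDistinguished {a} {b} {a'} {b'} {k} 2k<a 2k<b 2k<a' 2k<b' t =
    (λ g → let h , g∼h = Forth.alikePartner 2k<a' 2k<b' g in h , sameColor t g∼h)
  , (λ h → let g , h∼g = Back.alikePartner 2k<a 2k<b h in g , sameColor t (alike-sym {N} {M} h∼g))
  where
  M N : Z4Module
  M = ℤ/2ᵃ×ℤ/4ᵇ a b
  N = ℤ/2ᵃ×ℤ/4ᵇ a' b'

  module Forth = Extension M (finiteℤ/2ᵃ×ℤ/4ᵇ a b) a' b'
  module Back = Extension N (finiteℤ/2ᵃ×ℤ/4ᵇ a' b') a b

  sameColor : ∀ t {g h} → Alikeness.AlikeTuples M N g h →
              SameColor (Z4Module.group M) (Z4Module.group N) t g h
  sameColor = alike⇒sameColor (Forth.extend {k} 2k<a' 2k<b') (Back.extend {k} 2k<a 2k<b)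

sameOrder : ∀ {a b a' b'} → a + 2 * b ≡ a' + 2 * b' →
            SameOrder (Z4Module.group (ℤ/2ᵃ×ℤ/4ᵇ a b)) (Z4Module.group (ℤ/2ᵃ×ℤ/4ᵇ a' b'))
sameOrder {a} {b} {a'} {b'} eq =
  sameSize⇒sameOrder (Z4Module.group (ℤ/2ᵃ×ℤ/4ᵇ a b)) (Z4Module.group (ℤ/2ᵃ×ℤ/4ᵇ a' b'))
    (finiteℤ/2ᵃ×ℤ/4ᵇ a b) (finiteℤ/2ᵃ×ℤ/4ᵇ a' b')
    (trans (size≡ a b) (trans (cong (2 ^_) eq) (sym (size≡ a' b'))))
  where
  size≡ : ∀ a b → 2 ^ a * 4 ^ b ≡ 2 ^ (a + 2 * b)
  size≡ a b = trans (cong (2 ^ a *_) (ℕ.^-*-assoc 2 2 b)) (sym (ℕ.^-distribˡ-+-* 2 a (2 * b)))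

2[n/4]<n∸2 : ∀ m → 3 ≤ m → 2 * (suc (suc m) / 4) < m
2[n/4]<n∸2 m 3≤m = bound {suc (suc m) / 4} (ℕ.m/n*n≤m (suc (suc m)) 4)
  where
  bound : ∀ {k} → k * 4 ≤ 2 + m → 2 * k < m
  bound {0} _ = ℕ.<-≤-trans (s≤s z≤n) 3≤m
  bound {1} _ = 3≤m
  bound {suc (suc k)} (s≤s (s≤s 4k+6≤m)) =
    ℕ.≤-trans (subst (suc (2 * suc (suc k)) ≤_) (arithmetic k) (ℕ.m≤m+n _ (1 + 2 * k))) 4k+6≤m
    where
    arithmetic : ∀ k → suc (2 * suc (suc k)) + (1 + 2 * k) ≡ 2 + (4 + k * 4)
    arithmetic = RingSolver.solve-∀

mainTheorem12 : ∀ (n : ℕ) → 5 ≤ n →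
    ¬ (Gₙ n ≅ Hₙ n) × SameOrder (Gₙ n) (Hₙ n) × WLIINotDistinguish (n / 4) (Gₙ n) (Hₙ n)
mainTheorem12 n@(suc (suc m)) (s≤s (s≤s 3≤m)) =
  ℤ/4-rank<⇒≇ (ℕ.m<m+n n (s≤s z≤n)) , sameOrder (orders m) , sameOrder (orders m) ,
  notDistinguished 2k<n 2k<n 2k<m 2k<n+1
  where
  orders : ∀ m → suc (suc m) + 2 * suc (suc m) ≡ m + 2 * (suc (suc m) + 1)
  orders = RingSolver.solve-∀

  2k<m : 2 * (n / 4) < m
  2k<m = 2[n/4]<n∸2 m 3≤m

  2k<n : 2 * (n / 4) < n
  2k<n = ℕ.<-≤-trans 2k<m (ℕ.m≤n+m m 2)

  2k<n+1 : 2 * (n / 4) < n + 1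
  2k<n+1 = ℕ.<-≤-trans 2k<n (ℕ.m≤m+n n 1)
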